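{- Suppose that the edges of the complete bipartite graph $K_{n,n+t}$ are coloured with the $3$ colours red, blue, green. Then the vertex set of $K_{n,n+t}$ can be partitioned into one red path, two blue paths, four green paths and a set of $t$ vertices.
   Context: A single vertex and the empty graph are considered paths. -}

module Defs where

open import Data.Nat using (ℕ; _+_)
open import Data.Fin using (Fin)
open import Data.Sum using (_⊎_; inj₁; inj₂)
open import Data.Empty using (⊥)
open import Data.List using (List; map; _++_; length; allFin)
open import Data.List.Relation.Unary.Linked using (Linked)
open import Data.List.Relation.Unary.Unique.Propositional using (Unique)
open import Data.List.Relation.Binary.Permutation.Propositional using (_↭_)
open import Relation.Binary.PropositionalEquality using (_≡_)

data Colour : Set where
  red blue green : Colour

Vertex : ℕ → ℕ → Set
Vertex n m = Fin n ⊎ Fin m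

Colouring : ℕ → ℕ → Set
Colouring n m = Fin n → Fin m → Colour

ColEdge : ∀ {n m} → Colouring n m → Colour → Vertex n m → Vertex n m → Set
ColEdge c col (inj₁ i) (inj₂ j) = c i j ≡ col
ColEdge c col (inj₂ j) (inj₁ i) = c i j ≡ col
ColEdge c col (inj₁ _) (inj₁ _) = ⊥
ColEdge c col (inj₂ _) (inj₂ _) = ⊥

-- A path of colour col: a list of distinct vertices, consecutive ones joined
-- by an edge of colour col. The empty list and a single vertex are paths.
record IsPath {n m} (c : Colouring n m) (col : Colour) (p : List (Vertex n m)) : Set where
  field
    distinct : Unique p
    linked   : Linked (ColEdge c col) p

allVertices : (n m : ℕ) → List (Vertex n m)
allVertices n m = map inj₁ (allFin n) ++ map inj₂ (allFin m)

record Partition (n t : ℕ) (c : Colouring n (n + t)) : Set where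
  field
    r          : List (Vertex n (n + t))
    b₁ b₂      : List (Vertex n (n + t))
    g₁ g₂ g₃ g₄ : List (Vertex n (n + t))
    rest       : List (Vertex n (n + t))
    r-path     : IsPath c red r
    b₁-path    : IsPath c blue b₁
    b₂-path    : IsPath c blue b₂
    g₁-path    : IsPath c green g₁
    g₂-path    : IsPath c green g₂
    g₃-path    : IsPath c green g₃
    g₄-path    : IsPath c green g₄
    rest-size  : length rest ≡ t
    covers     : (r ++ b₁ ++ b₂ ++ g₁ ++ g₂ ++ g₃ ++ g₄ ++ rest) ↭ allVertices n (n + t)

-- Run a depth-first search in the red graph of a balanced piece K[A, B] (|A| = |B|),
-- stopping as soon as the finished set F and the unvisited set U have the same size.
-- The stack is a red path P, and no red edge joins F to U. Since P alternates sides,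
-- its two sides differ by at most one, and a parity count then forces
-- |A ∩ F| = |B ∩ U| and |A ∩ U| = |B ∩ F|: the rest of the vertex set splits into two
-- balanced pieces K[A ∩ F, B ∩ U] and K[A ∩ U, B ∩ F] without red edges. Repeating
-- the search with blue in each of them leaves four balanced pieces all of whose edges
-- are green, and each is covered by a single zigzag path. The t surplus vertices of
-- the larger side are set aside at the start.
module Submission where

open import Defs
open import Data.Nat using (ℕ; zero; suc; _+_; _*_; _∸_; _⊓_)
open import Data.Nat.Properties
  using (+-suc; +-comm; +-cancelˡ-≡; +-cancelʳ-≡; *-cancelˡ-≡; even≢odd; suc-injective;
         +-identityʳ; m≤m+n; m≤n⇒m⊓n≡m; m+n∸m≡n)
open import Data.Nat.Tactic.RingSolver using (solve-∀)
open import Data.Fin using (Fin)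
open import Data.Sum using (_⊎_; inj₁; inj₂; isInj₁; isInj₂)
open import Data.Sum.Properties using (inj₁-injective; inj₂-injective)
open import Data.Product using (Σ; ∃-syntax; _×_; _,_; proj₁; proj₂)
open import Data.Empty using (⊥-elim)
open import Data.List using (List; []; _∷_; map; _++_; length; allFin; take; drop; foldr; mapMaybe)
open import Data.List.Properties
  using (++-assoc; ++-identityʳ; map-++; length-map; length-++; length-take; length-drop;
         length-tabulate; take++drop≡id; mapMaybe-++; mapMaybeIsInj₁∘mapInj₁;
         mapMaybeIsInj₁∘mapInj₂; mapMaybeIsInj₂∘mapInj₂; mapMaybeIsInj₂∘mapInj₁)
open import Data.List.Relation.Unary.Linked using (Linked; []; [-]; _∷_; tail)
open import Data.List.Relation.Unary.All using (All; []; _∷_)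
open import Data.List.Relation.Unary.All.Properties using (++⁻ˡ)
open import Data.List.Relation.Unary.AllPairs using ([]; _∷_)
open import Data.List.Relation.Unary.Any using (Any; here; there; any?)
open import Data.List.Relation.Unary.Unique.Propositional using (Unique)
import Data.List.Relation.Unary.Unique.Propositional.Properties as Unique
open import Data.List.Membership.Propositional using (_∈_; lose)
open import Data.List.Membership.Propositional.Properties using (∈-++⁺ˡ; ∈-++⁺ʳ; ∈-map⁻)
open import Data.List.Relation.Binary.Subset.Propositional using (_⊆_)
open import Data.List.Relation.Binary.Permutation.Propositional
  using (_↭_; ↭-refl; ↭-sym; ↭-trans; ↭-reflexive; prep; swap; ↭⇒↭ₛ; module PermutationReasoning)
open import Data.List.Relation.Binary.Permutation.Propositional.Properties
  using (shift; shifts; map⁺; ++⁺; ++⁺ˡ; ++⁺ʳ; ++-comm; ∈-resp-↭; ↭-length; mapMaybe-↭)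
open import Data.List.Relation.Binary.Permutation.Setoid.Properties using (Unique-resp-↭)
open import Relation.Binary.PropositionalEquality
  using (_≡_; _≢_; refl; cong; cong₂; sym; trans; subst; setoid; module ≡-Reasoning)
open import Relation.Nullary using (Dec; yes; no; ¬_)

module _ {A : Set} where

  Unique-++⁻ : ∀ xs {ys : List A} → Unique (xs ++ ys) → Unique xs × Unique ys
  Unique-++⁻ []       u          = [] , u
  Unique-++⁻ (x ∷ xs) (x∉ ∷ u) with Unique-++⁻ xs u
  ... | uxs , uys = ++⁻ˡ xs x∉ ∷ uxs , uys

  foldr-++-Unique⁻ : ∀ (xss : List (List A)) {ys} → Unique (foldr _++_ ys xss) → All Unique xss
  foldr-++-Unique⁻ []         _ = []
  foldr-++-Unique⁻ (xs ∷ xss) u with Unique-++⁻ xs u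
  ... | uxs , urest = uxs ∷ foldr-++-Unique⁻ xss urest

  foldr-++-assoc : ∀ (xss : List (List A)) xs ys → foldr _++_ xs xss ++ ys ≡ foldr _++_ (xs ++ ys) xss
  foldr-++-assoc []         xs ys = refl
  foldr-++-assoc (zs ∷ xss) xs ys = trans (++-assoc zs _ ys) (cong (zs ++_) (foldr-++-assoc xss xs ys))

  Any⇒∷-↭ : ∀ {P : A → Set} {xs} → Any P xs → ∃[ x ] ∃[ ys ] P x × x ∷ ys ↭ xs
  Any⇒∷-↭ (here px) = _ , _ , px , ↭-refl
  Any⇒∷-↭ (there pxs) with Any⇒∷-↭ pxs
  ... | x , ys , px , x∷ys↭ = x , _ ∷ ys , px , ↭-trans (swap x _ ↭-refl) (prep _ x∷ys↭)

  shift² : ∀ (x : A) xs ys zs → x ∷ xs ++ ys ++ zs ↭ xs ++ ys ++ x ∷ zs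
  shift² x xs ys zs = ↭-trans (↭-sym (shift x xs (ys ++ zs))) (++⁺ˡ xs (↭-sym (shift x ys zs)))

data Near : ℕ → ℕ → Set where
  same  : ∀ {p} → Near p p
  above : ∀ {p} → Near (suc p) p
  below : ∀ {p} → Near p (suc p)

Near-cancel : ∀ {p q} x y → Near p q → p + 2 * x ≡ q + 2 * y → x ≡ y
Near-cancel {p} x y same  e = *-cancelˡ-≡ x y 2 (+-cancelˡ-≡ p _ _ e)
Near-cancel {p} x y below e = ⊥-elim (even≢odd x y (+-cancelˡ-≡ p _ _ (trans e (sym (+-suc p (2 * y))))))
Near-cancel {q = q} x y above e =
  ⊥-elim (even≢odd y x (+-cancelˡ-≡ q _ _ (trans (sym e) (sym (+-suc q (2 * x))))))

-- Adding the two hypotheses and cancelling ul + fr leaves p + 2 fl = q + 2 ur.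
cross-balance : ∀ {p q} fl ul fr ur → Near p q →
                p + (fl + ul) ≡ q + (fr + ur) → fl + fr ≡ ul + ur → fl ≡ ur × ul ≡ fr
cross-balance {p} {q} fl ul fr ur p~q sides halves = fl≡ur , ul≡fr
  where
  regroupˡ : ∀ p fl ul fr → (p + 2 * fl) + (ul + fr) ≡ (p + (fl + ul)) + (fl + fr)
  regroupˡ = solve-∀
  regroupʳ : ∀ q fr ur ul → (q + (fr + ur)) + (ul + ur) ≡ (q + 2 * ur) + (ul + fr)
  regroupʳ = solve-∀
  fl≡ur : fl ≡ ur
  fl≡ur = Near-cancel fl ur p~q (+-cancelʳ-≡ (ul + fr) _ _
            (trans (regroupˡ p fl ul fr) (trans (cong₂ _+_ sides halves) (regroupʳ q fr ur ul))))
  ul≡fr : ul ≡ fr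
  ul≡fr = +-cancelʳ-≡ ur ul fr (trans (sym halves) (trans (cong (_+ fr) fl≡ur) (+-comm ur fr)))

module _ {A B : Set} where

  lefts : List (A ⊎ B) → List A
  lefts = mapMaybe isInj₁

  rights : List (A ⊎ B) → List B
  rights = mapMaybe isInj₂

  vertices : List A → List B → List (A ⊎ B)
  vertices as bs = map inj₁ as ++ map inj₂ bs

  #lefts #rights : List (A ⊎ B) → ℕ
  #lefts xs = length (lefts xs)
  #rights xs = length (rights xs)

  lefts-vertices : ∀ as bs → lefts (vertices as bs) ≡ as
  lefts-vertices as bs = begin
    lefts (map inj₁ as ++ map inj₂ bs)               ≡⟨ mapMaybe-++ isInj₁ (map inj₁ as) _ ⟩
    lefts (map inj₁ as) ++ lefts (map inj₂ bs)       ≡⟨ cong₂ _++_ (mapMaybeIsInj₁∘mapInj₁ as) (mapMaybeIsInj₁∘mapInj₂ bs) ⟩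
    as ++ []                                         ≡⟨ ++-identityʳ as ⟩
    as                                               ∎
    where open ≡-Reasoning

  rights-vertices : ∀ as bs → rights (vertices as bs) ≡ bs
  rights-vertices as bs = begin
    rights (map inj₁ as ++ map inj₂ bs)              ≡⟨ mapMaybe-++ isInj₂ (map inj₁ as) _ ⟩
    rights (map inj₁ as) ++ rights (map inj₂ bs)     ≡⟨ cong₂ _++_ (mapMaybeIsInj₂∘mapInj₁ as) (mapMaybeIsInj₂∘mapInj₂ bs) ⟩
    bs                                               ∎
    where open ≡-Reasoning

  vertices-lefts-rights : ∀ xs → vertices (lefts xs) (rights xs) ↭ xs
  vertices-lefts-rights []            = ↭-refl
  vertices-lefts-rights (inj₁ a ∷ xs) = prep (inj₁ a) (vertices-lefts-rights xs)
  vertices-lefts-rights (inj₂ b ∷ xs) =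
    ↭-trans (shift (inj₂ b) (map inj₁ (lefts xs)) _) (prep (inj₂ b) (vertices-lefts-rights xs))

  vertices-++ : ∀ as bs as′ bs′ → vertices as bs ++ vertices as′ bs′ ↭ vertices (as ++ as′) (bs ++ bs′)
  vertices-++ as bs as′ bs′ = begin
    (map inj₁ as ++ map inj₂ bs) ++ map inj₁ as′ ++ map inj₂ bs′  ≡⟨ ++-assoc (map inj₁ as) _ _ ⟩
    map inj₁ as ++ map inj₂ bs ++ map inj₁ as′ ++ map inj₂ bs′    ↭⟨ ++⁺ˡ (map inj₁ as) (shifts (map inj₂ bs) (map inj₁ as′)) ⟩
    map inj₁ as ++ map inj₁ as′ ++ map inj₂ bs ++ map inj₂ bs′    ≡⟨ sym (++-assoc (map inj₁ as) _ _) ⟩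
    (map inj₁ as ++ map inj₁ as′) ++ map inj₂ bs ++ map inj₂ bs′  ≡⟨ cong₂ _++_ (sym (map-++ inj₁ as as′)) (sym (map-++ inj₂ bs bs′)) ⟩
    vertices (as ++ as′) (bs ++ bs′)                                ∎
    where open PermutationReasoning

  length-lefts+rights : ∀ xs → length xs ≡ #lefts xs + #rights xs
  length-lefts+rights []            = refl
  length-lefts+rights (inj₁ a ∷ xs) = cong suc (length-lefts+rights xs)
  length-lefts+rights (inj₂ b ∷ xs) = trans (cong suc (length-lefts+rights xs)) (sym (+-suc (#lefts xs) _))

  #lefts-++ : ∀ xs ys → #lefts (xs ++ ys) ≡ #lefts xs + #lefts ys
  #lefts-++ xs ys = trans (cong length (mapMaybe-++ isInj₁ xs ys)) (length-++ (lefts xs))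

  #rights-++ : ∀ xs ys → #rights (xs ++ ys) ≡ #rights xs + #rights ys
  #rights-++ xs ys = trans (cong length (mapMaybe-++ isInj₂ xs ys)) (length-++ (rights xs))

  #lefts-↭ : ∀ {xs ys} → xs ↭ ys → #lefts xs ≡ #lefts ys
  #lefts-↭ p = ↭-length (mapMaybe-↭ isInj₁ p)

  #rights-↭ : ∀ {xs ys} → xs ↭ ys → #rights xs ≡ #rights ys
  #rights-↭ p = ↭-length (mapMaybe-↭ isInj₂ p)

  ∈-lefts⁺ : ∀ {a} xs → inj₁ a ∈ xs → a ∈ lefts xs
  ∈-lefts⁺ (inj₁ a ∷ xs) (here refl) = here refl
  ∈-lefts⁺ (inj₁ a ∷ xs) (there p)   = there (∈-lefts⁺ xs p)
  ∈-lefts⁺ (inj₂ b ∷ xs) (there p)   = ∈-lefts⁺ xs p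

  ∈-lefts⁻ : ∀ {a} xs → a ∈ lefts xs → inj₁ a ∈ xs
  ∈-lefts⁻ (inj₁ a ∷ xs) (here refl) = here refl
  ∈-lefts⁻ (inj₁ a ∷ xs) (there p)   = there (∈-lefts⁻ xs p)
  ∈-lefts⁻ (inj₂ b ∷ xs) p           = there (∈-lefts⁻ xs p)

  ∈-rights⁺ : ∀ {b} xs → inj₂ b ∈ xs → b ∈ rights xs
  ∈-rights⁺ (inj₂ b ∷ xs) (here refl) = here refl
  ∈-rights⁺ (inj₂ b ∷ xs) (there p)   = there (∈-rights⁺ xs p)
  ∈-rights⁺ (inj₁ a ∷ xs) (there p)   = ∈-rights⁺ xs p

  ∈-rights⁻ : ∀ {b} xs → b ∈ rights xs → inj₂ b ∈ xs
  ∈-rights⁻ (inj₂ b ∷ xs) (here refl) = here refl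
  ∈-rights⁻ (inj₂ b ∷ xs) (there p)   = there (∈-rights⁻ xs p)
  ∈-rights⁻ (inj₁ a ∷ xs) p           = there (∈-rights⁻ xs p)

  lefts-⊆-vertices : ∀ {xs as bs} → xs ⊆ vertices as bs → lefts xs ⊆ as
  lefts-⊆-vertices {xs} {as} {bs} xs⊆ a∈ =
    subst (_ ∈_) (lefts-vertices as bs) (∈-lefts⁺ (vertices as bs) (xs⊆ (∈-lefts⁻ xs a∈)))

  rights-⊆-vertices : ∀ {xs as bs} → xs ⊆ vertices as bs → rights xs ⊆ bs
  rights-⊆-vertices {xs} {as} {bs} xs⊆ b∈ =
    subst (_ ∈_) (rights-vertices as bs) (∈-rights⁺ (vertices as bs) (xs⊆ (∈-rights⁻ xs b∈)))

  #lefts-≡-length : ∀ {xs as bs} → xs ↭ vertices as bs → #lefts xs ≡ length as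
  #lefts-≡-length {as = as} {bs} p = trans (#lefts-↭ p) (cong length (lefts-vertices as bs))

  #rights-≡-length : ∀ {xs as bs} → xs ↭ vertices as bs → #rights xs ≡ length bs
  #rights-≡-length {as = as} {bs} p = trans (#rights-↭ p) (cong length (rights-vertices as bs))

  cross-vertices-↭ : ∀ xs ys → vertices (lefts xs) (rights ys) ++ vertices (lefts ys) (rights xs) ↭ xs ++ ys
  cross-vertices-↭ xs ys = begin
    vertices (lefts xs) (rights ys) ++ vertices (lefts ys) (rights xs)
      ↭⟨ vertices-++ (lefts xs) (rights ys) (lefts ys) (rights xs) ⟩
    vertices (lefts xs ++ lefts ys) (rights ys ++ rights xs)
      ↭⟨ ++⁺ˡ (map inj₁ (lefts xs ++ lefts ys)) (map⁺ inj₂ (++-comm (rights ys) (rights xs))) ⟩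
    vertices (lefts xs ++ lefts ys) (rights xs ++ rights ys)
      ≡⟨ sym (cong₂ vertices (mapMaybe-++ isInj₁ xs ys) (mapMaybe-++ isInj₂ xs ys)) ⟩
    vertices (lefts (xs ++ ys)) (rights (xs ++ ys))
      ↭⟨ vertices-lefts-rights (xs ++ ys) ⟩
    xs ++ ys ∎
    where open PermutationReasoning

  zigzag : List A → List B → List (A ⊎ B)
  zigzag (a ∷ as) (b ∷ bs) = inj₁ a ∷ inj₂ b ∷ zigzag as bs
  zigzag as       bs       = vertices as bs

  zigzag-↭ : ∀ as bs → zigzag as bs ↭ vertices as bs
  zigzag-↭ []       bs       = ↭-refl
  zigzag-↭ (a ∷ as) []       = ↭-refl
  zigzag-↭ (a ∷ as) (b ∷ bs) =
    prep (inj₁ a) (↭-trans (prep (inj₂ b) (zigzag-↭ as bs)) (↭-sym (shift (inj₂ b) (map inj₁ as) _)))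

_≟ᶜ_ : (x y : Colour) → Dec (x ≡ y)
red   ≟ᶜ red   = yes refl
red   ≟ᶜ blue  = no λ ()
red   ≟ᶜ green = no λ ()
blue  ≟ᶜ red   = no λ ()
blue  ≟ᶜ blue  = yes refl
blue  ≟ᶜ green = no λ ()
green ≟ᶜ red   = no λ ()
green ≟ᶜ blue  = no λ ()
green ≟ᶜ green = yes refl

neither-red-nor-blue⇒green : ∀ x → x ≢ red → x ≢ blue → x ≡ green
neither-red-nor-blue⇒green red   x≢red _      = ⊥-elim (x≢red refl)
neither-red-nor-blue⇒green blue  _     x≢blue = ⊥-elim (x≢blue refl)
neither-red-nor-blue⇒green green _     _      = refl

module Coloured {n m : ℕ} (c : Colouring n m) where

  V : Set
  V = Vertex n m

  Walk : Colour → List V → Set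
  Walk col = Linked (ColEdge c col)

  ColEdge-sym : ∀ col {x y} → ColEdge c col x y → ColEdge c col y x
  ColEdge-sym col {inj₁ _} {inj₂ _} e = e
  ColEdge-sym col {inj₂ _} {inj₁ _} e = e

  ColEdge? : ∀ col x y → Dec (ColEdge c col x y)
  ColEdge? col (inj₁ a) (inj₂ b) = c a b ≟ᶜ col
  ColEdge? col (inj₂ b) (inj₁ a) = c a b ≟ᶜ col
  ColEdge? col (inj₁ _) (inj₁ _) = no λ ()
  ColEdge? col (inj₂ _) (inj₂ _) = no λ ()

  EdgesIn : (Colour → Set) → List (Fin n) → List (Fin m) → Set
  EdgesIn Q as bs = ∀ {a b} → a ∈ as → b ∈ bs → Q (c a b)

  tail-from-left : ∀ {col a xs} → Walk col (inj₁ a ∷ xs) →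
                   #rights xs ≡ #lefts xs ⊎ #rights xs ≡ suc (#lefts xs)
  tail-from-right : ∀ {col b xs} → Walk col (inj₂ b ∷ xs) →
                    #lefts xs ≡ #rights xs ⊎ #lefts xs ≡ suc (#rights xs)
  tail-from-left [-] = inj₁ refl
  tail-from-left {xs = inj₂ _ ∷ _} (_ ∷ w) with tail-from-right w
  ... | inj₁ eq = inj₂ (cong suc (sym eq))
  ... | inj₂ eq = inj₁ (sym eq)
  tail-from-right [-] = inj₁ refl
  tail-from-right {xs = inj₁ _ ∷ _} (_ ∷ w) with tail-from-left w
  ... | inj₁ eq = inj₂ (cong suc (sym eq))
  ... | inj₂ eq = inj₁ (sym eq)

  walk-near : ∀ {col xs} → Walk col xs → Near (#lefts xs) (#rights xs)
  walk-near [] = same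
  walk-near {xs = inj₁ _ ∷ xs} w with tail-from-left w
  ... | inj₁ eq rewrite eq = above
  ... | inj₂ eq rewrite eq = same
  walk-near {xs = inj₂ _ ∷ xs} w with tail-from-right w
  ... | inj₁ eq rewrite eq = below
  ... | inj₂ eq rewrite eq = same

  record DfsState (col : Colour) (W : List V) : Set where
    field
      walk finished unvisited : List V
      linked    : Walk col walk
      covers    : walk ++ finished ++ unvisited ↭ W
      separated : ∀ {x y} → x ∈ finished → y ∈ unvisited → ¬ ColEdge c col x y

  open DfsState

  Gap : ∀ {col W} → ℕ → DfsState col W → Set
  Gap d s = length (unvisited s) ≡ d + length (finished s)

  dfs-start : ∀ col W → DfsState col W
  dfs-start col W = record
    { walk = [] ; finished = [] ; unvisited = W ; linked = [] ; covers = ↭-refl ; separated = λ () }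

  dfs-step : ∀ {col W} d (s : DfsState col W) → Gap (suc d) s → Σ (DfsState col W) (Gap d)
  dfs-step d record { walk = [] ; unvisited = [] } ()
  dfs-step d s@record { walk = [] ; finished = F ; unvisited = u ∷ U } gap =
    record s { walk = u ∷ [] ; unvisited = U ; linked = [-]
             ; covers = ↭-trans (↭-sym (shift u F U)) (covers s)
             ; separated = λ x∈F y∈U → separated s x∈F (there y∈U) } ,
    suc-injective gap
  dfs-step {col} d s@record { walk = v ∷ P ; finished = F ; unvisited = U } gap
    with any? (λ u → ColEdge? col u v) U
  ... | yes ∃u =
    let u , U′ , u~v , U↭ = Any⇒∷-↭ ∃u in
    record s { walk = u ∷ v ∷ P ; unvisited = U′ ; linked = u~v ∷ linked s
             ; covers = ↭-trans (shift² u (v ∷ P) F U′) (↭-trans (++⁺ˡ (v ∷ P) (++⁺ˡ F U↭)) (covers s))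
             ; separated = λ x∈F y∈U′ → separated s x∈F (∈-resp-↭ U↭ (there y∈U′)) } ,
    suc-injective (trans (↭-length U↭) gap)
  ... | no ∄u =
    record s { walk = P ; finished = v ∷ F ; linked = tail (linked s)
             ; covers = ↭-trans (shift v P (F ++ U)) (covers s)
             ; separated = separated′ } ,
    trans gap (sym (+-suc d (length F)))
    where
    separated′ : ∀ {x y} → x ∈ v ∷ F → y ∈ U → ¬ ColEdge c col x y
    separated′ (here refl) y∈U v~y = ∄u (lose y∈U (ColEdge-sym col v~y))
    separated′ (there x∈F) y∈U     = separated s x∈F y∈U

  dfs-run : ∀ {col W} d (s : DfsState col W) → Gap d s → Σ (DfsState col W) (Gap 0)
  dfs-run zero    s gap = s , gap
  dfs-run (suc d) s gap with dfs-step d s gap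
  ... | s′ , gap′ = dfs-run d s′ gap′

  dfs : ∀ col W → Σ (DfsState col W) (Gap 0)
  dfs col W = dfs-run (length W) (dfs-start col W) (sym (+-identityʳ (length W)))

  record Block (col : Colour) (as : List (Fin n)) (bs : List (Fin m)) : Set where
    field
      left     : List (Fin n)
      right    : List (Fin m)
      left⊆    : left ⊆ as
      right⊆   : right ⊆ bs
      balanced : length left ≡ length right
      avoids   : EdgesIn (_≢ col) left right

    members : List V
    members = vertices left right

  record WalkSplit (col : Colour) (as : List (Fin n)) (bs : List (Fin m)) : Set where
    field
      walk          : List V
      linked        : Walk col walk
      block₁ block₂ : Block col as bs
      covers        : walk ++ Block.members block₁ ++ Block.members block₂ ↭ vertices as bs

  walkSplit : ∀ col as bs → length as ≡ length bs → WalkSplit col as bs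
  walkSplit col as bs |as|≡|bs| with dfs col (vertices as bs)
  ... | s@record { walk = P ; finished = F ; unvisited = U } , gap = record
    { walk   = P
    ; linked = linked s
    ; block₁ = record
      { left = lefts F ; right = rights U ; left⊆ = lefts-⊆-vertices F⊆ ; right⊆ = rights-⊆-vertices U⊆
      ; balanced = proj₁ counts ; avoids = λ a∈ b∈ → separated s (∈-lefts⁻ F a∈) (∈-rights⁻ U b∈) }
    ; block₂ = record
      { left = lefts U ; right = rights F ; left⊆ = lefts-⊆-vertices U⊆ ; right⊆ = rights-⊆-vertices F⊆
      ; balanced = proj₂ counts ; avoids = λ a∈ b∈ ab → separated s (∈-rights⁻ F b∈) (∈-lefts⁻ U a∈) ab }
    ; covers = ↭-trans (++⁺ˡ P (cross-vertices-↭ F U)) (covers s)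
    }
    where
    F⊆ : F ⊆ vertices as bs
    F⊆ x∈F = ∈-resp-↭ (covers s) (∈-++⁺ʳ P (∈-++⁺ˡ x∈F))
    U⊆ : U ⊆ vertices as bs
    U⊆ x∈U = ∈-resp-↭ (covers s) (∈-++⁺ʳ P (∈-++⁺ʳ F x∈U))
    sides : #lefts P + (#lefts F + #lefts U) ≡ #rights P + (#rights F + #rights U)
    sides = begin
      #lefts P + (#lefts F + #lefts U)     ≡⟨ sym (trans (#lefts-++ P _) (cong (#lefts P +_) (#lefts-++ F U))) ⟩
      #lefts (P ++ F ++ U)                 ≡⟨ #lefts-≡-length {as = as} {bs} (covers s) ⟩
      length as                            ≡⟨ |as|≡|bs| ⟩
      length bs                            ≡⟨ sym (#rights-≡-length {as = as} {bs} (covers s)) ⟩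
      #rights (P ++ F ++ U)                ≡⟨ trans (#rights-++ P _) (cong (#rights P +_) (#rights-++ F U)) ⟩
      #rights P + (#rights F + #rights U)  ∎
      where open ≡-Reasoning
    halves : #lefts F + #rights F ≡ #lefts U + #rights U
    halves = trans (sym (length-lefts+rights F)) (trans (sym gap) (length-lefts+rights U))
    counts : #lefts F ≡ #rights U × #lefts U ≡ #rights F
    counts = cross-balance (#lefts F) (#lefts U) (#rights F) (#rights U) (walk-near (linked s)) sides halves

  zigzag-walk : ∀ {col} as bs → length as ≡ length bs → EdgesIn (_≡ col) as bs → Walk col (zigzag as bs)
  zigzag-walk []            []            _   _    = []
  zigzag-walk (a ∷ [])      (b ∷ [])      _   mono = mono (here refl) (here refl) ∷ [-]
  zigzag-walk (a ∷ a′ ∷ as) (b ∷ b′ ∷ bs) len mono =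
    mono (here refl) (here refl) ∷ mono (there (here refl)) (here refl) ∷
    zigzag-walk (a′ ∷ as) (b′ ∷ bs) (suc-injective len) (λ a∈ b∈ → mono (there a∈) (there b∈))
  zigzag-walk []            (_ ∷ _)       ()  _
  zigzag-walk (_ ∷ _)       []            ()  _
  zigzag-walk (_ ∷ [])      (_ ∷ _ ∷ _)   ()  _
  zigzag-walk (_ ∷ _ ∷ _)   (_ ∷ [])      ()  _

  green-walk : ∀ {as bs} → EdgesIn (_≢ red) as bs → (block : Block blue as bs) →
               Walk green (zigzag (Block.left block) (Block.right block))
  green-walk no-red block = zigzag-walk left right balanced λ a∈ b∈ →
    neither-red-nor-blue⇒green _ (no-red (left⊆ a∈) (right⊆ b∈)) (avoids a∈ b∈)
    where open Block block

  record BlueGreenCover (as : List (Fin n)) (bs : List (Fin m)) : Set where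
    field
      b g₁ g₂ : List V
      b-walk  : Walk blue b
      g₁-walk : Walk green g₁
      g₂-walk : Walk green g₂
      covers  : b ++ g₁ ++ g₂ ↭ vertices as bs

  blueGreenCover : ∀ as bs → length as ≡ length bs → EdgesIn (_≢ red) as bs → BlueGreenCover as bs
  blueGreenCover as bs |as|≡|bs| no-red = record
    { b = S.walk ; g₁ = zigzag-of S.block₁ ; g₂ = zigzag-of S.block₂
    ; b-walk = S.linked ; g₁-walk = green-walk no-red S.block₁ ; g₂-walk = green-walk no-red S.block₂
    ; covers = ↭-trans (++⁺ˡ S.walk (++⁺ (zigzag-members S.block₁) (zigzag-members S.block₂))) S.covers
    }
    where
    module S = WalkSplit (walkSplit blue as bs |as|≡|bs|)
    zigzag-of : Block blue as bs → List V
    zigzag-of block = zigzag (Block.left block) (Block.right block)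
    zigzag-members : (block : Block blue as bs) → zigzag-of block ↭ Block.members block
    zigzag-members block = zigzag-↭ (Block.left block) (Block.right block)

  record ThreeColourCover (as : List (Fin n)) (bs : List (Fin m)) : Set where
    field
      r b₁ b₂ g₁ g₂ g₃ g₄ : List V
      r-walk  : Walk red r
      b₁-walk : Walk blue b₁
      b₂-walk : Walk blue b₂
      g₁-walk : Walk green g₁
      g₂-walk : Walk green g₂
      g₃-walk : Walk green g₃
      g₄-walk : Walk green g₄
      covers  : r ++ b₁ ++ b₂ ++ g₁ ++ g₂ ++ g₃ ++ g₄ ↭ vertices as bs

  threeColourCover : ∀ as bs → length as ≡ length bs → ThreeColourCover as bs
  threeColourCover as bs |as|≡|bs| = record
    { r = S.walk ; b₁ = X.b ; b₂ = Y.b ; g₁ = X.g₁ ; g₂ = X.g₂ ; g₃ = Y.g₁ ; g₄ = Y.g₂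
    ; r-walk = S.linked ; b₁-walk = X.b-walk ; b₂-walk = Y.b-walk
    ; g₁-walk = X.g₁-walk ; g₂-walk = X.g₂-walk ; g₃-walk = Y.g₁-walk ; g₄-walk = Y.g₂-walk
    ; covers = ↭-trans (++⁺ˡ S.walk (↭-trans regroup (++⁺ X.covers Y.covers))) S.covers
    }
    where
    module S = WalkSplit (walkSplit red as bs |as|≡|bs|)
    blueGreenCover-of : (block : Block red as bs) → BlueGreenCover (Block.left block) (Block.right block)
    blueGreenCover-of block = blueGreenCover left right balanced avoids
      where open Block block
    module X = BlueGreenCover (blueGreenCover-of S.block₁)
    module Y = BlueGreenCover (blueGreenCover-of S.block₂)
    regroup : X.b ++ Y.b ++ X.g₁ ++ X.g₂ ++ Y.g₁ ++ Y.g₂ ↭ (X.b ++ X.g₁ ++ X.g₂) ++ Y.b ++ Y.g₁ ++ Y.g₂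
    regroup = begin
      X.b ++ Y.b ++ X.g₁ ++ X.g₂ ++ Y.g₁ ++ Y.g₂      ≡⟨ cong (λ gs → X.b ++ Y.b ++ gs) (sym (++-assoc X.g₁ X.g₂ _)) ⟩
      X.b ++ Y.b ++ (X.g₁ ++ X.g₂) ++ Y.g₁ ++ Y.g₂    ↭⟨ ++⁺ˡ X.b (shifts Y.b (X.g₁ ++ X.g₂)) ⟩
      X.b ++ (X.g₁ ++ X.g₂) ++ Y.b ++ Y.g₁ ++ Y.g₂    ≡⟨ sym (++-assoc X.b (X.g₁ ++ X.g₂) _) ⟩
      (X.b ++ X.g₁ ++ X.g₂) ++ Y.b ++ Y.g₁ ++ Y.g₂    ∎
      where open PermutationReasoning

allVertices-unique : ∀ n m → Unique (allVertices n m)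
allVertices-unique n m =
  Unique.++⁺ (Unique.map⁺ inj₁-injective (Unique.allFin⁺ n)) (Unique.map⁺ inj₂-injective (Unique.allFin⁺ m)) disjoint
  where
  disjoint : ∀ {v} → ¬ (v ∈ map inj₁ (allFin n) × v ∈ map inj₂ (allFin m))
  disjoint (v∈ˡ , v∈ʳ) with ∈-map⁻ inj₁ v∈ˡ | ∈-map⁻ inj₂ v∈ʳ
  ... | _ , _ , refl | _ , _ , ()

allVertices-split : ∀ n t → allVertices n (n + t) ≡
  vertices (allFin n) (take n (allFin (n + t))) ++ map inj₂ (drop n (allFin (n + t)))
allVertices-split n t = sym (trans (++-assoc (map inj₁ (allFin n)) _ _)
  (cong (map inj₁ (allFin n) ++_) (trans (sym (map-++ inj₂ (take n B) (drop n B))) (cong (map inj₂) (take++drop≡id n B)))))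
  where B = allFin (n + t)

length-allFin : ∀ n → length (allFin n) ≡ n
length-allFin n = length-tabulate (λ i → i)

length-take-allFin : ∀ n t → length (take n (allFin (n + t))) ≡ n
length-take-allFin n t = trans (length-take n _) (trans (cong (n ⊓_) (length-allFin (n + t))) (m≤n⇒m⊓n≡m (m≤m+n n t)))

length-drop-allFin : ∀ n t → length (drop n (allFin (n + t))) ≡ t
length-drop-allFin n t = trans (length-drop n _) (trans (cong (_∸ n) (length-allFin (n + t))) (m+n∸m≡n n t))

lemma5p12 : (n t : ℕ) (c : Colouring n (n + t)) → Partition n t c
lemma5p12 n t c = partition (foldr-++-Unique⁻ (r ∷ b₁ ∷ b₂ ∷ g₁ ∷ g₂ ∷ g₃ ∷ g₄ ∷ []) distinct)
  where
  open Coloured c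
  open ThreeColourCover (threeColourCover (allFin n) (take n (allFin (n + t)))
                                          (trans (length-allFin n) (sym (length-take-allFin n t))))
  surplus : List V
  surplus = map inj₂ (drop n (allFin (n + t)))
  covers-all : r ++ b₁ ++ b₂ ++ g₁ ++ g₂ ++ g₃ ++ g₄ ++ surplus ↭ allVertices n (n + t)
  covers-all = ↭-trans (↭-reflexive (sym (foldr-++-assoc (r ∷ b₁ ∷ b₂ ∷ g₁ ∷ g₂ ∷ g₃ ∷ []) g₄ surplus)))
                       (↭-trans (++⁺ʳ surplus covers) (↭-reflexive (sym (allVertices-split n t))))
  distinct : Unique (r ++ b₁ ++ b₂ ++ g₁ ++ g₂ ++ g₃ ++ g₄ ++ surplus)
  distinct = Unique-resp-↭ (setoid V) (↭⇒↭ₛ (↭-sym covers-all)) (allVertices-unique n (n + t))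
  partition : All Unique (r ∷ b₁ ∷ b₂ ∷ g₁ ∷ g₂ ∷ g₃ ∷ g₄ ∷ []) → Partition n t c
  partition (ur ∷ ub₁ ∷ ub₂ ∷ ug₁ ∷ ug₂ ∷ ug₃ ∷ ug₄ ∷ []) = record
    { r = r ; b₁ = b₁ ; b₂ = b₂ ; g₁ = g₁ ; g₂ = g₂ ; g₃ = g₃ ; g₄ = g₄ ; rest = surplus
    ; r-path  = record { distinct = ur  ; linked = r-walk }
    ; b₁-path = record { distinct = ub₁ ; linked = b₁-walk }
    ; b₂-path = record { distinct = ub₂ ; linked = b₂-walk }
    ; g₁-path = record { distinct = ug₁ ; linked = g₁-walk }
    ; g₂-path = record { distinct = ug₂ ; linked = g₂-walk }
    ; g₃-path = record { distinct = ug₃ ; linked = g₃-walk }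
    ; g₄-path = record { distinct = ug₄ ; linked = g₄-walk }
    ; rest-size = trans (length-map inj₂ (drop n (allFin (n + t)))) (length-drop-allFin n t)
    ; covers = covers-all
    }
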